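{- Let $k\geqslant 2$ be an integer. Then, as $n\to\infty$, $$\tilde{R}_k(n)=\frac{k^2}{k^2+k+1}\,n+O\big((\log_k n)^2\big).$$
   Context: A set $A\subset\{1,\dots,n\}$ is $k$-free if $x\neq ky$ for all $x,y\in A$. $\tilde{R}_k(n)$ denotes the minimal cardinality of a $k$-free set $A\subset\{1,\dots,n\}$ which is maximal for inclusion among $k$-free subsets of $\{1,\dots,n\}$. -}

module Defs where

open import Data.Nat using (ℕ; zero; suc; _*_; _≟_; _+_; _^_; _≤?_)
open import Data.Fin using (Fin; toℕ)
open import Data.Fin.Subset using (Subset; _∈_; _∉_; ∣_∣; ⁅_⁆; _∪_)
open import Data.Fin.Subset.Properties using (_∈?_; anySubset?)
open import Data.Fin.Properties using (all?)
open import Data.Product using (_×_; Σ; _,_)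
open import Relation.Binary.PropositionalEquality using (_≡_; _≢_)
open import Relation.Nullary using (¬_; Dec; yes; no)
open import Relation.Nullary.Decidable using (_→-dec_; _×-dec_; ¬?)

-- The element x : Fin n represents the integer toℕ x + 1 ∈ {1,…,n}.
val : ∀ {n} → Fin n → ℕ
val x = suc (toℕ x)

KFree : ℕ → ∀ {n} → Subset n → Set
KFree k {n} A = ∀ (x y : Fin n) → x ∈ A → y ∈ A → val x ≢ k * val y

MaximalKFree : ℕ → ∀ {n} → Subset n → Set
MaximalKFree k {n} A = KFree k A × (∀ (x : Fin n) → x ∉ A → ¬ KFree k (⁅ x ⁆ ∪ A))

kfree? : ∀ k {n} (A : Subset n) → Dec (KFree k A)
kfree? k A = all? λ x → all? λ y → (x ∈? A) →-dec ((y ∈? A) →-dec ¬? (val x ≟ k * val y))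

maximalKFree? : ∀ k {n} (A : Subset n) → Dec (MaximalKFree k A)
maximalKFree? k A = kfree? k A ×-dec all? λ x → ¬? (x ∈? A) →-dec ¬? (kfree? k (⁅ x ⁆ ∪ A))

HasMaxKFreeOfSize : ℕ → ℕ → ℕ → Set
HasMaxKFreeOfSize k n r = Σ (Subset n) λ A → MaximalKFree k A × ∣ A ∣ ≡ r

search : ℕ → ℕ → ℕ → ℕ → ℕ
search k n r zero = r
search k n r (suc fuel) with anySubset? {n = n} (λ A → maximalKFree? k A ×-dec (∣ A ∣ ≟ r))
... | yes _ = r
... | no _ = search k n (suc r) fuel

-- R̃_k(n): the minimal cardinality of a maximal k-free subset of {1,…,n}
-- (such sets exist and have cardinality ≤ n, so the search over 0..n is exhaustive).
Rtilde : ℕ → ℕ → ℕ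
Rtilde k n = search k n 0 n

-- ⌊log_k n⌋: the largest e with k^e ≤ n (for k ≥ 2, n ≥ 1); e ≤ n so fuel n suffices.
logSearch : ℕ → ℕ → ℕ → ℕ → ℕ
logSearch k n e zero = e
logSearch k n e (suc fuel) with k ^ suc e ≤? n
... | yes _ = logSearch k n (suc e) fuel
... | no _ = e

floorLog : ℕ → ℕ → ℕ
floorLog k n = logSearch k n 0 n

-- Let height n x be the largest t with kᵗ x ≤ n, and N₀ n the number of x ∈ {1,…,n} of height ≡ 0 (mod 3).
-- If A is maximal k-free, then by maximality one of x, k x, x / k lies in A for every x; since two distinct
-- x of height ≡ 0 (mod 3) never differ by a factor k or k², this choice is injective on them, so ∣A∣ ≥ N₀ n.
-- Conversely, the x of height ≡ 1 together with the x of height ≡ 0 not divisible by k form a maximal k-free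
-- set, which injects into the x of height ≡ 0 by x ↦ x or k x. Hence R̃ₖ(n) = N₀ n exactly.
-- Elements above n / k have height 0, those in (n / k³, n / k] height 1 or 2, and height n (k³ x) equals
-- height (n / k³) x, so N₀ n = (n − ⌊n/k⌋) + N₀ ⌊n/k³⌋. Since (k²+k+1)(n − ⌊n/k⌋) + k² ⌊n/k³⌋ is within
-- k² + k of k² n, unrolling over the ⌊log_k n⌋ + 1 levels gives the estimate, with error even O(log_k n).

{-# OPTIONS --safe #-}
module Submission where

open import Defs
open import Data.Bool using (Bool; true; false; T; _∧_; _∨_; not; if_then_else_)
open import Data.Bool.Properties using (not-injective; ∧-identityʳ; T-≡)
open import Data.Empty using (⊥; ⊥-elim)
open import Data.Fin using (Fin; toℕ; fromℕ<) renaming (zero to fzero; suc to fsuc)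
open import Data.Fin.Properties using (toℕ-fromℕ<; toℕ<n)
open import Data.Fin.Subset using (Subset; _∈_; _∉_; ∣_∣; ⁅_⁆; _∪_)
open import Data.Fin.Subset.Properties using (x∈p∪q⁻; x∈p∪q⁺; x∈⁅x⁆; x∈⁅y⁆⇒x≡y; anySubset?; ∣p∣≤n)
open import Data.Nat
open import Data.Nat.DivMod
open import Data.Nat.Properties
open import Data.Nat.Tactic.RingSolver using (solve-∀)
open import Data.Product using (Σ; _×_; _,_; proj₁; proj₂)
open import Data.Sum using (_⊎_; inj₁; inj₂)
open import Function.Bundles using (Equivalence)
open import Data.Vec using (_∷_; []; tabulate; here; there)
open import Relation.Binary.PropositionalEquality
open import Relation.Nullary using (¬_; yes; no)
open import Relation.Nullary.Decidable using (_×-dec_)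

≡true⇒T : ∀ {b} → b ≡ true → T b
≡true⇒T = Equivalence.from T-≡

T⇒≡true : ∀ {b} → T b → b ≡ true
T⇒≡true = Equivalence.to T-≡

true≢false : true ≢ false
true≢false ()

<ᵇ≡true⇒< : ∀ {m n} → (m <ᵇ n) ≡ true → m < n
<ᵇ≡true⇒< {m} {n} e = <ᵇ⇒< m n (≡true⇒T e)

<⇒<ᵇ≡true : ∀ {m n} → m < n → (m <ᵇ n) ≡ true
<⇒<ᵇ≡true m<n = T⇒≡true (<⇒<ᵇ m<n)

≤ᵇ≡true⇒≤ : ∀ {m n} → (m ≤ᵇ n) ≡ true → m ≤ n
≤ᵇ≡true⇒≤ {m} {n} e = ≤ᵇ⇒≤ m n (≡true⇒T e)

≤⇒≤ᵇ≡true : ∀ {m n} → m ≤ n → (m ≤ᵇ n) ≡ true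
≤⇒≤ᵇ≡true m≤n = T⇒≡true (≤⇒≤ᵇ m≤n)

≡ᵇ≡true⇒≡ : ∀ {m n} → (m ≡ᵇ n) ≡ true → m ≡ n
≡ᵇ≡true⇒≡ {m} {n} e = ≡ᵇ⇒≡ m n (≡true⇒T e)

≡⇒≡ᵇ≡true : ∀ {m n} → m ≡ n → (m ≡ᵇ n) ≡ true
≡⇒≡ᵇ≡true {m} {n} m≡n = T⇒≡true (≡⇒≡ᵇ m n m≡n)

*-≤⇒≤-/ : ∀ d x n .{{_ : NonZero d}} → d * x ≤ n → x ≤ n / d
*-≤⇒≤-/ d x n le = subst (_≤ n / d) (trans (cong (_/ d) (*-comm d x)) (m*n/n≡m x d)) (/-monoˡ-≤ d le)

≤-/⇒*-≤ : ∀ d x n .{{_ : NonZero d}} → x ≤ n / d → d * x ≤ n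
≤-/⇒*-≤ d x n le = ≤-trans (*-monoʳ-≤ d le) (subst (_≤ n) (*-comm (n / d) d) (m/n*n≤m n d))

indicator : Bool → ℕ
indicator true = 1
indicator false = 0

count : (ℕ → Bool) → ℕ → ℕ
count p zero = 0
count p (suc n) = count p n + indicator (p (suc n))

count-cong : ∀ {p q : ℕ → Bool} n → (∀ x → 1 ≤ x → x ≤ n → p x ≡ q x) → count p n ≡ count q n
count-cong zero _ = refl
count-cong (suc n) p≡q =
  cong₂ _+_ (count-cong n (λ x 1≤x x≤n → p≡q x 1≤x (m≤n⇒m≤1+n x≤n))) (cong indicator (p≡q (suc n) z<s ≤-refl))

count-suc : ∀ (p : ℕ → Bool) n → count p (suc n) ≡ indicator (p 1) + count (λ x → p (suc x)) n
count-suc p zero = +-comm 0 _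
count-suc p (suc n) = trans (cong (_+ indicator (p (2 + n))) (count-suc p n)) (+-assoc (indicator (p 1)) _ _)

+-interchange : ∀ a b c d → a + b + (c + d) ≡ a + c + (b + d)
+-interchange = solve-∀

count-∨ : ∀ (p q : ℕ → Bool) n → (∀ x → 1 ≤ x → x ≤ n → p x ≡ true → q x ≡ false) →
  count (λ x → p x ∨ q x) n ≡ count p n + count q n
count-∨ p q zero _ = refl
count-∨ p q (suc n) disjoint
  rewrite count-∨ p q n (λ x 1≤x x≤n → disjoint x 1≤x (m≤n⇒m≤1+n x≤n))
  with p (suc n) in p[1+n] | q (suc n) in q[1+n]
... | true  | true  = ⊥-elim (true≢false (trans (sym q[1+n]) (disjoint (suc n) z<s ≤-refl p[1+n])))
... | true  | false = +-interchange (count p n) (count q n) 1 0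
... | false | b     = +-interchange (count p n) (count q n) 0 (indicator b)

count-<ᵇ : ∀ a n → count (a <ᵇ_) n ≡ n ∸ a
count-<ᵇ a zero = sym (0∸n≡0 a)
count-<ᵇ a (suc n) with a <ᵇ suc n in a<ᵇ1+n
... | true rewrite count-<ᵇ a n =
  trans (+-comm (n ∸ a) 1) (sym (+-∸-assoc 1 (s≤s⁻¹ (<ᵇ≡true⇒< {a} a<ᵇ1+n))))
... | false rewrite count-<ᵇ a n =
  trans (+-identityʳ _) (trans (m≤n⇒m∸n≡0 (≤-trans (n≤1+n n) 1+n≤a)) (sym (m≤n⇒m∸n≡0 1+n≤a)))
  where 1+n≤a : suc n ≤ a
        1+n≤a = ≮⇒≥ (λ a<1+n → true≢false (trans (sym (<⇒<ᵇ≡true a<1+n)) a<ᵇ1+n))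

count-≤ᵇ-∧ : ∀ (q : ℕ → Bool) m d → count (λ x → (x ≤ᵇ m) ∧ q x) (m + d) ≡ count q m
count-≤ᵇ-∧ q m zero =
  trans (cong (count _) (+-identityʳ m)) (count-cong m λ x _ x≤m → cong (_∧ q x) (≤⇒≤ᵇ≡true x≤m))
count-≤ᵇ-∧ q m (suc d) rewrite +-suc m d =
  trans (cong₂ _+_ (count-≤ᵇ-∧ q m d) (cong indicator beyond)) (+-identityʳ _)
  where beyond : ((suc (m + d) ≤ᵇ m) ∧ q (suc (m + d))) ≡ false
        beyond with suc (m + d) ≤ᵇ m in le
        ... | true = ⊥-elim (<⇒≱ (s≤s (m≤m+n m d)) (≤ᵇ≡true⇒≤ le))
        ... | false = refl

count-remove : ∀ (q : ℕ → Bool) y m → 1 ≤ y → y ≤ m → q y ≡ true →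
  count (λ z → q z ∧ not (z ≡ᵇ y)) m + 1 ≡ count q m
count-remove q zero zero () z≤n _
count-remove q y (suc m) 1≤y y≤1+m qy with suc m ≡ᵇ y in 1+m≡ᵇy
... | true with ≡ᵇ≡true⇒≡ {suc m} {y} 1+m≡ᵇy
...   | refl rewrite qy =
  trans (+-assoc _ 0 1) (cong (_+ 1) (count-cong m λ x _ x≤m → below x x≤m))
  where below : ∀ x → x ≤ m → (q x ∧ not (x ≡ᵇ suc m)) ≡ q x
        below x x≤m with x ≡ᵇ suc m in x≡ᵇ1+m
        ... | true = ⊥-elim (1+n≰n (subst (_≤ m) (≡ᵇ≡true⇒≡ x≡ᵇ1+m) x≤m))
        ... | false = ∧-identityʳ (q x)
count-remove q y (suc m) 1≤y y≤1+m qy | false =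
  trans (swap _ (indicator (q (suc m) ∧ true)))
        (cong₂ _+_ (count-remove q y m 1≤y y≤m qy) (cong indicator (∧-identityʳ _)))
  where
  swap : ∀ a b → a + b + 1 ≡ a + 1 + b
  swap = solve-∀
  y≤m : y ≤ m
  y≤m with m≤n⇒m<n∨m≡n y≤1+m
  ... | inj₁ y<1+m = s≤s⁻¹ y<1+m
  ... | inj₂ refl = ⊥-elim (true≢false (trans (sym (≡⇒≡ᵇ≡true {suc m} refl)) 1+m≡ᵇy))

count-≤-injection : ∀ n m (p q : ℕ → Bool) (f : ℕ → ℕ) →
  (∀ x → 1 ≤ x → x ≤ n → p x ≡ true → (1 ≤ f x) × (f x ≤ m) × (q (f x) ≡ true)) →
  (∀ x y → 1 ≤ x → x ≤ n → 1 ≤ y → y ≤ n → p x ≡ true → p y ≡ true → f x ≡ f y → x ≡ y) →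
  count p n ≤ count q m
count-≤-injection zero m p q f maps inj = z≤n
count-≤-injection (suc n) m p q f maps inj with p (suc n) in p[1+n]
... | false = subst (_≤ count q m) (sym (+-identityʳ _)) (count-≤-injection n m p q f
      (λ x 1≤x x≤n → maps x 1≤x (m≤n⇒m≤1+n x≤n))
      (λ x y 1≤x x≤n 1≤y y≤n → inj x y 1≤x (m≤n⇒m≤1+n x≤n) 1≤y (m≤n⇒m≤1+n y≤n)))
... | true = begin
    count p n + 1            ≤⟨ +-monoˡ-≤ 1 rest ⟩
    count q′ m + 1           ≡⟨ count-remove q y m 1≤y y≤m qy ⟩
    count q m                ∎
  where
  open ≤-Reasoning
  y = f (suc n)
  1≤y = proj₁ (maps (suc n) z<s ≤-refl p[1+n])
  y≤m = proj₁ (proj₂ (maps (suc n) z<s ≤-refl p[1+n]))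
  qy = proj₂ (proj₂ (maps (suc n) z<s ≤-refl p[1+n]))
  q′ : ℕ → Bool
  q′ z = q z ∧ not (z ≡ᵇ y)
  avoids-y : ∀ x → 1 ≤ x → x ≤ n → p x ≡ true → q (f x) ≡ true → q′ (f x) ≡ true
  avoids-y x 1≤x x≤n px qfx with f x ≡ᵇ y in fx≡ᵇy
  ... | true = ⊥-elim (1+n≰n (subst (_≤ n)
      (inj x (suc n) 1≤x (m≤n⇒m≤1+n x≤n) z<s ≤-refl px p[1+n] (≡ᵇ≡true⇒≡ fx≡ᵇy)) x≤n))
  ... | false = trans (∧-identityʳ _) qfx
  rest : count p n ≤ count q′ m
  rest = count-≤-injection n m p q′ f
    (λ x 1≤x x≤n px → let (1≤fx , fx≤m , qfx) = maps x 1≤x (m≤n⇒m≤1+n x≤n) px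
                      in 1≤fx , fx≤m , avoids-y x 1≤x x≤n px qfx)
    (λ x y 1≤x x≤n 1≤y y≤n → inj x y 1≤x (m≤n⇒m≤1+n x≤n) 1≤y (m≤n⇒m≤1+n y≤n))

-- memberᵇ A v decides val x ∈ A for the x with val x ≡ v, and is false for v outside 1 … n
memberᵇ : ∀ {n} → Subset n → ℕ → Bool
memberᵇ [] v = false
memberᵇ (b ∷ A) zero = false
memberᵇ (b ∷ A) (suc zero) = b
memberᵇ (b ∷ A) (suc (suc v)) = memberᵇ A (suc v)

∣A∣≡count-memberᵇ : ∀ {n} (A : Subset n) → ∣ A ∣ ≡ count (memberᵇ A) n
∣A∣≡count-memberᵇ [] = refl
∣A∣≡count-memberᵇ {suc n} (b ∷ A) = begin
  ∣ b ∷ A ∣                                    ≡⟨ head+tail b ⟩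
  indicator b + count (memberᵇ A) n            ≡⟨ cong (indicator b +_) (count-cong n λ { (suc x) _ _ → refl }) ⟩
  indicator b + count (λ x → memberᵇ (b ∷ A) (suc x)) n ≡⟨ count-suc (memberᵇ (b ∷ A)) n ⟨
  count (memberᵇ (b ∷ A)) (suc n)              ∎
  where
  open ≡-Reasoning
  head+tail : ∀ b → ∣ b ∷ A ∣ ≡ indicator b + count (memberᵇ A) n
  head+tail true = cong suc (∣A∣≡count-memberᵇ A)
  head+tail false = ∣A∣≡count-memberᵇ A

∈⇒memberᵇ : ∀ {n} (A : Subset n) (x : Fin n) → x ∈ A → memberᵇ A (val x) ≡ true
∈⇒memberᵇ (true ∷ A) fzero here = refl
∈⇒memberᵇ (b ∷ A) (fsuc x) (there x∈A) = ∈⇒memberᵇ A x x∈A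

memberᵇ⇒∈ : ∀ {n} (A : Subset n) (x : Fin n) → memberᵇ A (val x) ≡ true → x ∈ A
memberᵇ⇒∈ (true ∷ A) fzero _ = here
memberᵇ⇒∈ (b ∷ A) (fsuc x) x∈A = there (memberᵇ⇒∈ A x x∈A)

∉⇒memberᵇ≡false : ∀ {n} (A : Subset n) (x : Fin n) → x ∉ A → memberᵇ A (val x) ≡ false
∉⇒memberᵇ≡false A x x∉A with memberᵇ A (val x) in x∈ᵇA
... | true = ⊥-elim (x∉A (memberᵇ⇒∈ A x x∈ᵇA))
... | false = refl

memberᵇ≡false⇒∉ : ∀ {n} (A : Subset n) (x : Fin n) → memberᵇ A (val x) ≡ false → x ∉ A
memberᵇ≡false⇒∉ A x x∉ᵇA x∈A = true≢false (trans (sym (∈⇒memberᵇ A x x∈A)) x∉ᵇA)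

memberᵇ⇒inRange : ∀ {n} (A : Subset n) v → memberᵇ A v ≡ true → (1 ≤ v) × (v ≤ n)
memberᵇ⇒inRange (b ∷ A) (suc zero) _ = s≤s z≤n , s≤s z≤n
memberᵇ⇒inRange (b ∷ A) (suc (suc v)) v∈ᵇA = s≤s z≤n , s≤s (proj₂ (memberᵇ⇒inRange A (suc v) v∈ᵇA))

fromValue : ∀ {n} v → 1 ≤ v → v ≤ n → Σ (Fin n) λ x → val x ≡ v
fromValue (suc v) _ v<n = fromℕ< v<n , cong suc (toℕ-fromℕ< v<n)

memberᵇ⇒∈-fromValue : ∀ {n} (A : Subset n) v → memberᵇ A v ≡ true → Σ (Fin n) λ x → val x ≡ v × x ∈ A
memberᵇ⇒∈-fromValue A v v∈ᵇA with memberᵇ⇒inRange A v v∈ᵇA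
... | 1≤v , v≤n with fromValue v 1≤v v≤n
...   | x , refl = x , refl , memberᵇ⇒∈ A x v∈ᵇA

memberᵇ-tabulate : ∀ {n} (p : ℕ → Bool) v → 1 ≤ v → v ≤ n → memberᵇ (tabulate {n = n} (λ i → p (val i))) v ≡ p v
memberᵇ-tabulate {suc n} p (suc zero) _ _ = refl
memberᵇ-tabulate {suc n} p (suc (suc v)) _ (s≤s v<n) = memberᵇ-tabulate {n} (λ x → p (suc x)) (suc v) (s≤s z≤n) v<n

memberᵇ-KFree : ∀ k {n} (A : Subset n) →
  (∀ u w → memberᵇ A u ≡ true → memberᵇ A w ≡ true → u ≢ k * w) → KFree k A
memberᵇ-KFree k A free x y x∈A y∈A = free (val x) (val y) (∈⇒memberᵇ A x x∈A) (∈⇒memberᵇ A y y∈A)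

memberᵇ-MaximalKFree : ∀ k {n} (A : Subset n) → KFree k A →
  (∀ v → 1 ≤ v → v ≤ n → memberᵇ A v ≡ false →
     (memberᵇ A (k * v) ≡ true) ⊎ (Σ ℕ λ w → (v ≡ k * w) × (memberᵇ A w ≡ true))) →
  MaximalKFree k A
memberᵇ-MaximalKFree k {n} A free conflict = free , λ x x∉A free′ →
  blocked x free′ (conflict (val x) (s≤s z≤n) (toℕ<n x) (∉⇒memberᵇ≡false A x x∉A))
  where
  blocked : ∀ x → KFree k (⁅ x ⁆ ∪ A) →
    (memberᵇ A (k * val x) ≡ true) ⊎ (Σ ℕ λ w → (val x ≡ k * w) × (memberᵇ A w ≡ true)) → ⊥
  blocked x free′ (inj₁ kx∈ᵇA) with memberᵇ⇒∈-fromValue A _ kx∈ᵇA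
  ... | y , y≡kx , y∈A = free′ y x (x∈p∪q⁺ (inj₂ y∈A)) (x∈p∪q⁺ (inj₁ (x∈⁅x⁆ x))) y≡kx
  blocked x free′ (inj₂ (w , x≡kw , w∈ᵇA)) with memberᵇ⇒∈-fromValue A w w∈ᵇA
  ... | y , refl , y∈A = free′ x y (x∈p∪q⁺ (inj₁ (x∈⁅x⁆ x))) (x∈p∪q⁺ (inj₂ y∈A)) x≡kw

search-spec : ∀ k n fuel r r* → r ≤ r* → r* ≤ r + fuel → HasMaxKFreeOfSize k n r* →
  (search k n r fuel ≤ r*) × HasMaxKFreeOfSize k n (search k n r fuel)
search-spec k n zero r r* r≤r* r*≤r+0 has-r* =
  r≤r* , subst (HasMaxKFreeOfSize k n) (≤-antisym r*≤r r≤r*) has-r*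
  where r*≤r = subst (r* ≤_) (+-identityʳ r) r*≤r+0
search-spec k n (suc fuel) r r* r≤r* r*≤r+1+fuel has-r* with anySubset? {n = n} (λ A → maximalKFree? k A ×-dec (∣ A ∣ ≟ r))
... | yes has-r = r≤r* , has-r
... | no ¬has-r = search-spec k n fuel (suc r) r* (≤∧≢⇒< r≤r* r≢r*) (subst (r* ≤_) (+-suc r fuel) r*≤r+1+fuel) has-r*
  where r≢r* : r ≢ r*
        r≢r* refl = ¬has-r has-r*

Rtilde-spec : ∀ k n r* → r* ≤ n → HasMaxKFreeOfSize k n r* → (Rtilde k n ≤ r*) × HasMaxKFreeOfSize k n (Rtilde k n)
Rtilde-spec k n r* r*≤n = search-spec k n n 0 r* z≤n r*≤n

mod3 : ℕ → ℕ
mod3 0 = 0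
mod3 1 = 1
mod3 2 = 2
mod3 (suc (suc (suc a))) = mod3 a

mod3-cases : ∀ a → (mod3 a ≡ 0) ⊎ (mod3 a ≡ 1) ⊎ (mod3 a ≡ 2)
mod3-cases 0 = inj₁ refl
mod3-cases 1 = inj₂ (inj₁ refl)
mod3-cases 2 = inj₂ (inj₂ refl)
mod3-cases (suc (suc (suc a))) = mod3-cases a

mod3-suc-0 : ∀ a → mod3 a ≡ 0 → mod3 (suc a) ≡ 1
mod3-suc-0 0 _ = refl
mod3-suc-0 (suc (suc (suc a))) = mod3-suc-0 a

mod3-suc-1 : ∀ a → mod3 a ≡ 1 → mod3 (suc a) ≡ 2
mod3-suc-1 1 _ = refl
mod3-suc-1 (suc (suc (suc a))) = mod3-suc-1 a

mod3-2+-0 : ∀ a → mod3 a ≡ 0 → mod3 (2 + a) ≡ 2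
mod3-2+-0 0 _ = refl
mod3-2+-0 (suc (suc (suc a))) = mod3-2+-0 a

mod3-suc≡1 : ∀ a → mod3 (suc a) ≡ 1 → mod3 a ≡ 0
mod3-suc≡1 0 _ = refl
mod3-suc≡1 (suc (suc (suc a))) = mod3-suc≡1 a

mod3-suc≡2 : ∀ a → mod3 (suc a) ≡ 2 → mod3 a ≡ 1
mod3-suc≡2 1 _ = refl
mod3-suc≡2 (suc (suc (suc a))) = mod3-suc≡2 a

module _ (j : ℕ) where
  k : ℕ
  k = 2 + j

  k³ : ℕ
  k³ = k * (k * k)

  instance
    k³-nonZero : NonZero k³
    k³-nonZero = _

  <k* : ∀ {y} → 1 ≤ y → y < k * y
  <k* {y} 1≤y = ≤-trans (≤-reflexive (+-comm 1 y)) (+-monoʳ-≤ y (≤-trans 1≤y (m≤m+n y (j * y))))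

  ≤k* : ∀ {y} → 1 ≤ y → y ≤ k * y
  ≤k* 1≤y = <⇒≤ (<k* 1≤y)

  1≤k* : ∀ {y} → 1 ≤ y → 1 ≤ k * y
  1≤k* 1≤y = ≤-trans 1≤y (≤k* 1≤y)

  1≤k : 1 ≤ k
  1≤k = s≤s z≤n

  k≤k³ : k ≤ k³
  k≤k³ = ≤-trans (≤k* 1≤k) (≤k* (1≤k* 1≤k))

  k*k*k : ∀ x → k * (k * (k * x)) ≡ k³ * x
  k*k*k x = assoc k x
    where assoc : ∀ k x → k * (k * (k * x)) ≡ k * (k * k) * x
          assoc = solve-∀

  heightFuel : ℕ → ℕ → ℕ → ℕ
  heightFuel zero n x = 0
  heightFuel (suc f) n x = if k * x ≤ᵇ n then suc (heightFuel f n (k * x)) else 0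

  -- the fuel n suffices, since t < kᵗ x ≤ n for x ≥ 1
  height : ℕ → ℕ → ℕ
  height n x = heightFuel n n x

  heightFuel-irrelevant : ∀ f g n y → 1 ≤ y → n < y + f → n < y + g → heightFuel f n y ≡ heightFuel g n y
  heightFuel-irrelevant zero zero n y _ _ _ = refl
  heightFuel-irrelevant zero (suc g) n y 1≤y n<y _ with k * y ≤ᵇ n in ky≤ᵇn
  ... | true = ⊥-elim (<⇒≱ (subst (n <_) (+-identityʳ y) n<y) (≤-trans (≤k* 1≤y) (≤ᵇ≡true⇒≤ ky≤ᵇn)))
  ... | false = refl
  heightFuel-irrelevant (suc f) zero n y 1≤y _ n<y with k * y ≤ᵇ n in ky≤ᵇn
  ... | true = ⊥-elim (<⇒≱ (subst (n <_) (+-identityʳ y) n<y) (≤-trans (≤k* 1≤y) (≤ᵇ≡true⇒≤ ky≤ᵇn)))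
  ... | false = refl
  heightFuel-irrelevant (suc f) (suc g) n y 1≤y n<y+1+f n<y+1+g with k * y ≤ᵇ n
  ... | true = cong suc (heightFuel-irrelevant f g n (k * y) (1≤k* 1≤y) (shift f n<y+1+f) (shift g n<y+1+g))
    where shift : ∀ f → n < y + suc f → n < k * y + f
          shift f n< = ≤-trans n< (subst (_≤ k * y + f) (sym (+-suc y f)) (+-monoˡ-≤ f (<k* 1≤y)))
  ... | false = refl

  height-step : ∀ n x → 1 ≤ x → k * x ≤ n → height n x ≡ suc (height n (k * x))
  height-step zero x 1≤x kx≤0 = ⊥-elim (<⇒≱ (1≤k* 1≤x) kx≤0)
  height-step (suc n) x 1≤x kx≤1+n rewrite ≤⇒≤ᵇ≡true kx≤1+n =
    cong suc (heightFuel-irrelevant n (suc n) (suc n) (k * x) (1≤k* 1≤x)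
      (+-monoˡ-≤ n (≤-trans (s≤s 1≤x) (<k* 1≤x))) (m<n+m (suc n) (1≤k* 1≤x)))

  height-top : ∀ n x → ¬ (k * x ≤ n) → height n x ≡ 0
  height-top zero x _ = refl
  height-top (suc n) x kx≰1+n with k * x ≤ᵇ suc n in kx≤ᵇ1+n
  ... | true = ⊥-elim (kx≰1+n (≤ᵇ≡true⇒≤ kx≤ᵇ1+n))
  ... | false = refl

  height≡suc⇒k*≤ : ∀ n x t → height n x ≡ suc t → k * x ≤ n
  height≡suc⇒k*≤ (suc n) x t h≡1+t with k * x ≤ᵇ suc n in kx≤ᵇ1+n
  ... | true = ≤ᵇ≡true⇒≤ kx≤ᵇ1+n

  height-3+ : ∀ n x → 1 ≤ x → k³ * x ≤ n → height n x ≡ 3 + height n (k³ * x)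
  height-3+ n x 1≤x k³x≤n = begin
    height n x                        ≡⟨ height-step n x 1≤x k¹x≤n ⟩
    suc (height n (k * x))            ≡⟨ cong suc (height-step n (k * x) (1≤k* 1≤x) k²x≤n) ⟩
    2 + height n (k * (k * x))        ≡⟨ cong (2 +_) (height-step n (k * (k * x)) (1≤k* (1≤k* 1≤x)) k³x≤n′) ⟩
    3 + height n (k * (k * (k * x)))  ≡⟨ cong (λ z → 3 + height n z) (k*k*k x) ⟩
    3 + height n (k³ * x)             ∎
    where
    open ≡-Reasoning
    k³x≤n′ : k * (k * (k * x)) ≤ n
    k³x≤n′ = subst (_≤ n) (sym (k*k*k x)) k³x≤n
    k²x≤n : k * (k * x) ≤ n
    k²x≤n = ≤-trans (≤k* (1≤k* (1≤k* 1≤x))) k³x≤n′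
    k¹x≤n : k * x ≤ n
    k¹x≤n = ≤-trans (≤k* (1≤k* 1≤x)) k²x≤n

  k*k³≡k³*k : ∀ y → k * (k³ * y) ≡ k³ * (k * y)
  k*k³≡k³*k y = swap k y
    where swap : ∀ k y → k * (k * (k * k) * y) ≡ k * (k * k) * (k * y)
          swap = solve-∀

  k³*≤ᵇ≡≤ᵇ/k³ : ∀ z n → (k³ * z ≤ᵇ n) ≡ (z ≤ᵇ n / k³)
  k³*≤ᵇ≡≤ᵇ/k³ z n with k³ * z ≤ᵇ n in k³z≤ᵇn | z ≤ᵇ n / k³ in z≤ᵇn/k³
  ... | true  | true  = refl
  ... | false | false = refl
  ... | true  | false = ⊥-elim (true≢false (trans (sym (≤⇒≤ᵇ≡true (*-≤⇒≤-/ k³ z n (≤ᵇ≡true⇒≤ k³z≤ᵇn)))) z≤ᵇn/k³))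
  ... | false | true  = ⊥-elim (true≢false (trans (sym (≤⇒≤ᵇ≡true (≤-/⇒*-≤ k³ z n (≤ᵇ≡true⇒≤ z≤ᵇn/k³)))) k³z≤ᵇn))

  heightFuel-k³ : ∀ f n y → heightFuel f n (k³ * y) ≡ heightFuel f (n / k³) y
  heightFuel-k³ zero n y = refl
  heightFuel-k³ (suc f) n y =
    trans (cong (λ z → if z ≤ᵇ n then suc (heightFuel f n z) else 0) (k*k³≡k³*k y))
          (cong₂ (λ b h → if b then suc h else 0) (k³*≤ᵇ≡≤ᵇ/k³ (k * y) n) (heightFuel-k³ f n (k * y)))

  height-k³ : ∀ n x → 1 ≤ x → height n (k³ * x) ≡ height (n / k³) x
  height-k³ n x 1≤x = trans (heightFuel-k³ n n x) (heightFuel-irrelevant n (n / k³) (n / k³) x 1≤x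
      (≤-trans (s≤s (m/n≤m n k³)) (m<n+m n 1≤x)) (m<n+m (n / k³) 1≤x))

  height≡0mod3 : ℕ → ℕ → Bool
  height≡0mod3 n x = mod3 (height n x) ≡ᵇ 0

  N₀ : ℕ → ℕ
  N₀ n = count (height≡0mod3 n) n

  height-middle : ∀ n x → 1 ≤ x → k * x ≤ n → ¬ (k³ * x ≤ n) → (height n x ≡ 1) ⊎ (height n x ≡ 2)
  height-middle n x 1≤x kx≤n k³x≰n with k * (k * x) ≤? n
  ... | yes k²x≤n = inj₂ (trans (height-step n x 1≤x kx≤n) (cong suc (trans
        (height-step n (k * x) (1≤k* 1≤x) k²x≤n)
        (cong suc (height-top n (k * (k * x)) λ k³x≤n → k³x≰n (subst (_≤ n) (k*k*k x) k³x≤n))))))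
  ... | no k²x≰n = inj₁ (trans (height-step n x 1≤x kx≤n) (cong suc (height-top n (k * x) k²x≰n)))

  height≡0mod3-unfold : ∀ n x → 1 ≤ x →
    height≡0mod3 n x ≡ (n / k <ᵇ x) ∨ ((x ≤ᵇ n / k³) ∧ height≡0mod3 (n / k³) x)
  height≡0mod3-unfold n x 1≤x with n / k <ᵇ x in n/k<ᵇx | x ≤ᵇ n / k³ in x≤ᵇn/k³
  ... | true | _ = cong (λ h → mod3 h ≡ᵇ 0)
        (height-top n x λ kx≤n → <⇒≱ (<ᵇ≡true⇒< n/k<ᵇx) (*-≤⇒≤-/ k x n kx≤n))
  ... | false | true = cong (λ h → mod3 h ≡ᵇ 0)
        (trans (height-3+ n x 1≤x (≤-/⇒*-≤ k³ x n (≤ᵇ≡true⇒≤ x≤ᵇn/k³))) (cong (3 +_) (height-k³ n x 1≤x)))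
  ... | false | false with height-middle n x 1≤x kx≤n k³x≰n
    where
    kx≤n : k * x ≤ n
    kx≤n = ≤-/⇒*-≤ k x n (≮⇒≥ λ n/k<x → true≢false (trans (sym (<⇒<ᵇ≡true n/k<x)) n/k<ᵇx))
    k³x≰n : ¬ (k³ * x ≤ n)
    k³x≰n k³x≤n = true≢false (trans (sym (≤⇒≤ᵇ≡true (*-≤⇒≤-/ k³ x n k³x≤n))) x≤ᵇn/k³)
  ...   | inj₁ h≡1 = cong (λ h → mod3 h ≡ᵇ 0) h≡1
  ...   | inj₂ h≡2 = cong (λ h → mod3 h ≡ᵇ 0) h≡2

  N₀-recursion : ∀ n → N₀ n ≡ (n ∸ n / k) + N₀ (n / k³)
  N₀-recursion n = begin
    N₀ n                                                        ≡⟨ count-cong n (λ x 1≤x _ → height≡0mod3-unfold n x 1≤x) ⟩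
    count (λ x → (n / k <ᵇ x) ∨ ((x ≤ᵇ m) ∧ height≡0mod3 m x)) n ≡⟨ count-∨ _ _ n disjoint ⟩
    count (n / k <ᵇ_) n + count (λ x → (x ≤ᵇ m) ∧ height≡0mod3 m x) n
                                                                ≡⟨ cong₂ _+_ (count-<ᵇ (n / k) n) truncate ⟩
    (n ∸ n / k) + N₀ m                                          ∎
    where
    open ≡-Reasoning
    m = n / k³
    m≤n/k : m ≤ n / k
    m≤n/k = /-monoʳ-≤ n k≤k³
    disjoint : ∀ x → 1 ≤ x → x ≤ n → (n / k <ᵇ x) ≡ true → ((x ≤ᵇ m) ∧ height≡0mod3 m x) ≡ false
    disjoint x _ _ n/k<ᵇx with x ≤ᵇ m in x≤ᵇm
    ... | true = ⊥-elim (<⇒≱ (<ᵇ≡true⇒< {n / k} {x} n/k<ᵇx) (≤-trans (≤ᵇ≡true⇒≤ {x} {m} x≤ᵇm) m≤n/k))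
    ... | false = refl
    truncate : count (λ x → (x ≤ᵇ m) ∧ height≡0mod3 m x) n ≡ N₀ m
    truncate = trans (cong (count _) (sym (m+[n∸m]≡n (m/n≤m n k³)))) (count-≤ᵇ-∧ (height≡0mod3 m) m (n ∸ m))

  P Q c : ℕ
  P = k * k + k + 1
  Q = k * k
  c = k * k + k

  -- n = r + a k and a = s + m k², with r = n mod k, s = a mod k², m = ⌊n / k³⌋
  level-identity : ∀ n → P * (n ∸ n / k) + Q * (n / k³) + (n / k) % (k * k) ≡ Q * n + (k + 1) * (n % k)
  level-identity n = begin
    P * (n ∸ a) + Q * m + s                       ≡⟨ cong (λ z → P * z + Q * m + s) n∸a ⟩
    P * (suc j * (s + m * (k * k)) + r) + Q * m + s ≡⟨ identity j r s m ⟩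
    Q * (r + (s + m * (k * k)) * k) + (k + 1) * r ≡⟨ cong (λ z → Q * z + (k + 1) * r) n≡ ⟨
    Q * n + (k + 1) * r                           ∎
    where
    open ≡-Reasoning
    a = n / k
    r = n % k
    s = a % (k * k)
    m = n / k³
    a≡ : a ≡ s + m * (k * k)
    a≡ = trans (m≡m%n+[m/n]*n a (k * k)) (cong (λ z → s + z * (k * k)) (m/n/o≡m/[n*o] n k (k * k)))
    n≡ : n ≡ r + (s + m * (k * k)) * k
    n≡ = trans (m≡m%n+[m/n]*n n k) (cong (λ z → r + z * k) a≡)
    n∸a : n ∸ a ≡ suc j * (s + m * (k * k)) + r
    n∸a = begin
      n ∸ a                         ≡⟨ cong (_∸ a) (trans (m≡m%n+[m/n]*n n k) (split j r a)) ⟩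
      suc j * a + r + a ∸ a          ≡⟨ m+n∸n≡m (suc j * a + r) a ⟩
      suc j * a + r                 ≡⟨ cong (λ z → suc j * z + r) a≡ ⟩
      suc j * (s + m * (k * k)) + r ∎
      where split : ∀ i r a → r + a * suc (suc i) ≡ suc i * a + r + a
            split = solve-∀
    identity : ∀ i r s m →
      (suc (suc i) * suc (suc i) + suc (suc i) + 1) * (suc i * (s + m * (suc (suc i) * suc (suc i))) + r)
        + suc (suc i) * suc (suc i) * m + s
      ≡ suc (suc i) * suc (suc i) * (r + (s + m * (suc (suc i) * suc (suc i))) * suc (suc i)) + (suc (suc i) + 1) * r
    identity = solve-∀

  level-upper : ∀ n → P * (n ∸ n / k) + Q * (n / k³) ≤ Q * n + c
  level-upper n = begin
    P * (n ∸ n / k) + Q * (n / k³)                      ≤⟨ m≤m+n _ _ ⟩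
    P * (n ∸ n / k) + Q * (n / k³) + (n / k) % (k * k)  ≡⟨ level-identity n ⟩
    Q * n + (k + 1) * (n % k)                           ≤⟨ +-monoʳ-≤ (Q * n) (*-monoʳ-≤ (k + 1) (<⇒≤ (m%n<n n k))) ⟩
    Q * n + (k + 1) * k                                 ≡⟨ cong (Q * n +_) (expand k) ⟩
    Q * n + c                                           ∎
    where
    open ≤-Reasoning
    expand : ∀ k → (k + 1) * k ≡ k * k + k
    expand = solve-∀

  level-lower : ∀ n → Q * n ≤ P * (n ∸ n / k) + Q * (n / k³) + c
  level-lower n = begin
    Q * n                                               ≤⟨ m≤m+n _ _ ⟩
    Q * n + (k + 1) * (n % k)                           ≡⟨ level-identity n ⟨
    P * (n ∸ n / k) + Q * (n / k³) + (n / k) % (k * k)  ≤⟨ +-monoʳ-≤ _ (≤-trans (<⇒≤ (m%n<n (n / k) (k * k))) (m≤m+n (k * k) k)) ⟩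
    P * (n ∸ n / k) + Q * (n / k³) + c                  ∎
    where open ≤-Reasoning

  N₀-approx : ∀ t n → n < k³ ^ t → (P * N₀ n ≤ Q * n + c * t) × (Q * n ≤ P * N₀ n + c * t)
  N₀-approx zero (suc n) (s≤s ())
  N₀-approx zero zero _ rewrite *-zeroʳ P | *-zeroʳ Q | *-zeroʳ c = z≤n , z≤n
  N₀-approx (suc t) n n<k³^[1+t] = upper , lower
    where
    open ≤-Reasoning
    m = n / k³
    A = P * (n ∸ n / k)
    IH = N₀-approx t m (m<n*o⇒m/o<n (subst (n <_) (*-comm k³ (k³ ^ t)) n<k³^[1+t]))
    PN₀ : P * N₀ n ≡ A + P * N₀ m
    PN₀ = trans (cong (P *_) (N₀-recursion n)) (*-distribˡ-+ P (n ∸ n / k) (N₀ m))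
    c+ct : ∀ x → x + c + c * t ≡ x + c * suc t
    c+ct x = trans (+-assoc x c (c * t)) (cong (x +_) (sym (*-suc c t)))
    upper : P * N₀ n ≤ Q * n + c * suc t
    upper = begin
      P * N₀ n                ≡⟨ PN₀ ⟩
      A + P * N₀ m            ≤⟨ +-monoʳ-≤ A (proj₁ IH) ⟩
      A + (Q * m + c * t)     ≡⟨ +-assoc A _ _ ⟨
      A + Q * m + c * t       ≤⟨ +-monoˡ-≤ (c * t) (level-upper n) ⟩
      Q * n + c + c * t       ≡⟨ c+ct (Q * n) ⟩
      Q * n + c * suc t       ∎
    lower : Q * n ≤ P * N₀ n + c * suc t
    lower = begin
      Q * n                       ≤⟨ level-lower n ⟩
      A + Q * m + c               ≤⟨ +-monoˡ-≤ c (+-monoʳ-≤ A (proj₂ IH)) ⟩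
      A + (P * N₀ m + c * t) + c  ≡⟨ rearrange A (P * N₀ m) (c * t) c ⟩
      A + P * N₀ m + c + c * t    ≡⟨ cong (λ z → z + c + c * t) PN₀ ⟨
      P * N₀ n + c + c * t        ≡⟨ c+ct (P * N₀ n) ⟩
      P * N₀ n + c * suc t        ∎
      where rearrange : ∀ a b d e → a + (b + d) + e ≡ a + b + e + d
            rearrange = solve-∀

  k*w/k≡w : ∀ w → (k * w) / k ≡ w
  k*w/k≡w w = trans (cong (_/ k) (*-comm k w)) (m*n/n≡m w k)

  ∪-singleton-KFree : ∀ {n} (A : Subset n) x → KFree k A → memberᵇ A (k * val x) ≡ false →
    ¬ ((memberᵇ A (val x / k) ≡ true) × (val x ≡ k * (val x / k))) → KFree k (⁅ x ⁆ ∪ A)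
  ∪-singleton-KFree A x free kx∉ᵇA x/k∉ᵇA a b a∈ b∈ a≡kb with x∈p∪q⁻ ⁅ x ⁆ A a∈ | x∈p∪q⁻ ⁅ x ⁆ A b∈
  ... | inj₂ a∈A | inj₂ b∈A = free a b a∈A b∈A a≡kb
  ... | inj₁ a∈⁅x⁆ | inj₂ b∈A rewrite x∈⁅y⁆⇒x≡y x a∈⁅x⁆ =
    x/k∉ᵇA (trans (cong (memberᵇ A) x/k≡b) (∈⇒memberᵇ A b b∈A) , trans a≡kb (cong (k *_) (sym x/k≡b)))
    where x/k≡b : val x / k ≡ val b
          x/k≡b = trans (cong (_/ k) a≡kb) (k*w/k≡w (val b))
  ... | inj₂ a∈A | inj₁ b∈⁅x⁆ rewrite x∈⁅y⁆⇒x≡y x b∈⁅x⁆ =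
    true≢false (trans (sym (∈⇒memberᵇ A a a∈A)) (trans (cong (memberᵇ A) a≡kb) kx∉ᵇA))
  ... | inj₁ a∈⁅x⁆ | inj₁ b∈⁅x⁆ rewrite x∈⁅y⁆⇒x≡y x a∈⁅x⁆ | x∈⁅y⁆⇒x≡y x b∈⁅x⁆ = <⇒≢ (<k* (s≤s z≤n)) a≡kb

  MaximalKFree⇒conflict : ∀ {n} (A : Subset n) → MaximalKFree k A → ∀ v → 1 ≤ v → v ≤ n → memberᵇ A v ≡ false →
    (memberᵇ A (k * v) ≡ true) ⊎ ((memberᵇ A (v / k) ≡ true) × (v ≡ k * (v / k)))
  MaximalKFree⇒conflict A (free , maximal) v 1≤v v≤n v∉ᵇA with fromValue v 1≤v v≤n
  ... | x , refl with memberᵇ A (k * val x) in kx∈ᵇA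
  ...   | true = inj₁ refl
  ...   | false with memberᵇ A (val x / k) in x/k∈ᵇA | val x ≟ k * (val x / k)
  ...     | true | yes x≡k[x/k] = inj₂ (refl , x≡k[x/k])
  ...     | true | no x≢k[x/k] = ⊥-elim (maximal x (memberᵇ≡false⇒∉ A x v∉ᵇA)
      (∪-singleton-KFree A x free kx∈ᵇA λ (_ , x≡k[x/k]) → x≢k[x/k] x≡k[x/k]))
  ...     | false | _ = ⊥-elim (maximal x (memberᵇ≡false⇒∉ A x v∉ᵇA)
      (∪-singleton-KFree A x free kx∈ᵇA λ (x/k∈ᵇA′ , _) → true≢false (trans (sym x/k∈ᵇA′) x/k∈ᵇA)))

  height≡0mod3-apart : ∀ n u v → 1 ≤ v → u ≤ n → (u ≡ k * v) ⊎ (u ≡ k * (k * v)) →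
    height≡0mod3 n u ≡ true → height≡0mod3 n v ≡ true → ⊥
  height≡0mod3-apart n u v 1≤v u≤n (inj₁ refl) u₀ v₀ = 1+n≢0 (begin
    1                               ≡⟨ mod3-suc-0 (height n u) (≡ᵇ≡true⇒≡ {mod3 (height n u)} u₀) ⟨
    mod3 (suc (height n u))         ≡⟨ cong mod3 (height-step n v 1≤v u≤n) ⟨
    mod3 (height n v)               ≡⟨ ≡ᵇ≡true⇒≡ {mod3 (height n v)} v₀ ⟩
    0                               ∎)
    where open ≡-Reasoning
  height≡0mod3-apart n u v 1≤v u≤n (inj₂ refl) u₀ v₀ = 1+n≢0 (begin
    2                               ≡⟨ mod3-2+-0 (height n u) (≡ᵇ≡true⇒≡ {mod3 (height n u)} u₀) ⟨
    mod3 (2 + height n u)           ≡⟨ cong (λ h → mod3 (suc h)) (height-step n (k * v) (1≤k* 1≤v) u≤n) ⟨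
    mod3 (suc (height n (k * v)))   ≡⟨ cong mod3 (height-step n v 1≤v (≤-trans (≤k* (1≤k* 1≤v)) u≤n)) ⟨
    mod3 (height n v)               ≡⟨ ≡ᵇ≡true⇒≡ {mod3 (height n v)} v₀ ⟩
    0                               ∎)
    where open ≡-Reasoning

  Neighbour : ℕ → ℕ → Set
  Neighbour x z = (z ≡ x) ⊎ (z ≡ k * x) ⊎ ((x ≡ k * z) × (1 ≤ z))

  module _ {n} (A : Subset n) (A-maximal : MaximalKFree k A) where
    representative : ℕ → ℕ
    representative x = if memberᵇ A x then x else (if memberᵇ A (k * x) then k * x else x / k)

    representative-spec : ∀ x → 1 ≤ x → x ≤ n → (memberᵇ A (representative x) ≡ true) × Neighbour x (representative x)
    representative-spec x 1≤x x≤n with memberᵇ A x in x∈ᵇA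
    ... | true = x∈ᵇA , inj₁ refl
    ... | false with memberᵇ A (k * x) in kx∈ᵇA
    ...   | true = kx∈ᵇA , inj₂ (inj₁ refl)
    ...   | false with MaximalKFree⇒conflict A A-maximal x 1≤x x≤n x∈ᵇA
    ...     | inj₁ kx∈ᵇA′ = ⊥-elim (true≢false (trans (sym kx∈ᵇA′) kx∈ᵇA))
    ...     | inj₂ (x/k∈ᵇA , x≡k[x/k]) = x/k∈ᵇA , inj₂ (inj₂ (x≡k[x/k] , proj₁ (memberᵇ⇒inRange A _ x/k∈ᵇA)))

    representative-injective : ∀ x y → 1 ≤ x → x ≤ n → 1 ≤ y → y ≤ n →
      height≡0mod3 n x ≡ true → height≡0mod3 n y ≡ true → representative x ≡ representative y → x ≡ y
    representative-injective x y 1≤x x≤n 1≤y y≤n x₀ y₀ eq =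
      compareNeighbours (proj₂ (representative-spec x 1≤x x≤n)) (proj₂ (representative-spec y 1≤y y≤n))
      where
      apart-xy : (x ≡ k * y) ⊎ (x ≡ k * (k * y)) → x ≡ y
      apart-xy x≡ = ⊥-elim (height≡0mod3-apart n x y 1≤y x≤n x≡ x₀ y₀)
      apart-yx : (y ≡ k * x) ⊎ (y ≡ k * (k * x)) → x ≡ y
      apart-yx y≡ = ⊥-elim (height≡0mod3-apart n y x 1≤x y≤n y≡ y₀ x₀)
      compareNeighbours : Neighbour x (representative x) → Neighbour y (representative y) → x ≡ y
      compareNeighbours (inj₁ a) (inj₁ b) = trans (sym a) (trans eq b)
      compareNeighbours (inj₂ (inj₁ a)) (inj₂ (inj₁ b)) = *-cancelˡ-≡ x y k (trans (sym a) (trans eq b))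
      compareNeighbours (inj₂ (inj₂ (a , _))) (inj₂ (inj₂ (b , _))) = trans a (trans (cong (k *_) eq) (sym b))
      compareNeighbours (inj₁ a) (inj₂ (inj₁ b)) = apart-xy (inj₁ (trans (sym a) (trans eq b)))
      compareNeighbours (inj₁ a) (inj₂ (inj₂ (b , _))) = apart-yx (inj₁ (trans b (cong (k *_) (trans (sym eq) a))))
      compareNeighbours (inj₂ (inj₁ a)) (inj₁ b) = apart-yx (inj₁ (trans (sym b) (trans (sym eq) a)))
      compareNeighbours (inj₂ (inj₁ a)) (inj₂ (inj₂ (b , _))) = apart-yx (inj₂ (trans b (cong (k *_) (trans (sym eq) a))))
      compareNeighbours (inj₂ (inj₂ (a , _))) (inj₁ b) = apart-xy (inj₁ (trans a (cong (k *_) (trans eq b))))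
      compareNeighbours (inj₂ (inj₂ (a , _))) (inj₂ (inj₁ b)) = apart-xy (inj₂ (trans a (cong (k *_) (trans eq b))))

    N₀≤∣A∣ : N₀ n ≤ ∣ A ∣
    N₀≤∣A∣ = subst (N₀ n ≤_) (sym (∣A∣≡count-memberᵇ A))
      (count-≤-injection n n (height≡0mod3 n) (memberᵇ A) representative
        (λ x 1≤x x≤n _ → let z∈ᵇA = proj₁ (representative-spec x 1≤x x≤n)
                         in proj₁ (memberᵇ⇒inRange A _ z∈ᵇA) , proj₂ (memberᵇ⇒inRange A _ z∈ᵇA) , z∈ᵇA)
        representative-injective)

  height≡1mod3 : ℕ → ℕ → Bool
  height≡1mod3 n x = mod3 (height n x) ≡ᵇ 1

  inB : ℕ → ℕ → Bool
  inB n x = height≡1mod3 n x ∨ (height≡0mod3 n x ∧ not (x % k ≡ᵇ 0))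

  k*w%k≡ᵇ0 : ∀ w → ((k * w) % k ≡ᵇ 0) ≡ true
  k*w%k≡ᵇ0 w = ≡⇒≡ᵇ≡true (trans (cong (_% k) (*-comm k w)) (m*n%n≡0 w k))

  inB-1mod3 : ∀ n x → mod3 (height n x) ≡ 1 → inB n x ≡ true
  inB-1mod3 n x h≡1 rewrite h≡1 = refl

  inB-0mod3 : ∀ n x → mod3 (height n x) ≡ 0 → inB n x ≡ not (x % k ≡ᵇ 0)
  inB-0mod3 n x h≡0 rewrite h≡0 = refl

  inB-2mod3 : ∀ n x → mod3 (height n x) ≡ 2 → inB n x ≡ false
  inB-2mod3 n x h≡2 rewrite h≡2 = refl

  inB-k*-0mod3 : ∀ n x w → x ≡ k * w → mod3 (height n x) ≡ 0 → inB n x ≡ false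
  inB-k*-0mod3 n x w refl h≡0 rewrite h≡0 | k*w%k≡ᵇ0 w = refl

  inB-KFree-step : ∀ n w → 1 ≤ w → k * w ≤ n → inB n (k * w) ≡ true → inB n w ≡ true → ⊥
  inB-KFree-step n w 1≤w kw≤n kw∈B w∈B with mod3-cases (height n (k * w))
  ... | inj₁ h≡0 = true≢false (trans (sym kw∈B) (inB-k*-0mod3 n (k * w) w refl h≡0))
  ... | inj₂ (inj₂ h≡2) = true≢false (trans (sym kw∈B) (inB-2mod3 n (k * w) h≡2))
  ... | inj₂ (inj₁ h≡1) = true≢false (trans (sym w∈B)
        (inB-2mod3 n w (trans (cong mod3 (height-step n w 1≤w kw≤n)) (mod3-suc-1 (height n (k * w)) h≡1))))

  module _ (n : ℕ) where
    B : Subset n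
    B = tabulate (λ i → inB n (val i))

    memberᵇ-B : ∀ v → 1 ≤ v → v ≤ n → memberᵇ B v ≡ inB n v
    memberᵇ-B = memberᵇ-tabulate (inB n)

    memberᵇ-B⇒inB : ∀ v → memberᵇ B v ≡ true → inB n v ≡ true
    memberᵇ-B⇒inB v v∈ᵇB = let (1≤v , v≤n) = memberᵇ⇒inRange B v v∈ᵇB in trans (sym (memberᵇ-B v 1≤v v≤n)) v∈ᵇB

    B-KFree : KFree k B
    B-KFree = memberᵇ-KFree k B λ u w u∈ᵇB w∈ᵇB u≡kw →
      inB-KFree-step n w (proj₁ (memberᵇ⇒inRange B w w∈ᵇB)) (subst (_≤ n) u≡kw (proj₂ (memberᵇ⇒inRange B u u∈ᵇB)))
        (subst (λ z → inB n z ≡ true) u≡kw (memberᵇ-B⇒inB u u∈ᵇB)) (memberᵇ-B⇒inB w w∈ᵇB)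

    divisor-∈B : ∀ v → 1 ≤ v → v ≤ n → mod3 (height n v) ≡ 0 → (v % k ≡ᵇ 0) ≡ true →
      Σ ℕ λ w → (v ≡ k * w) × (memberᵇ B w ≡ true)
    divisor-∈B v 1≤v v≤n h≡0 k∣ᵇv =
      v / k , v≡k[v/k] , trans (memberᵇ-B (v / k) 1≤v/k (≤-trans (m/n≤m v k) v≤n)) (inB-1mod3 n (v / k) h[v/k]≡1)
      where
      v≡k[v/k] : v ≡ k * (v / k)
      v≡k[v/k] = trans (m≡m%n+[m/n]*n v k) (trans (cong (_+ (v / k) * k) (≡ᵇ≡true⇒≡ k∣ᵇv)) (*-comm (v / k) k))
      1≤v/k : 1 ≤ v / k
      1≤v/k with v / k | v≡k[v/k]
      ... | zero | v≡0 = ⊥-elim (<⇒≱ 1≤v (≤-reflexive (trans v≡0 (*-zeroʳ k))))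
      ... | suc _ | _ = s≤s z≤n
      h[v/k]≡1 : mod3 (height n (v / k)) ≡ 1
      h[v/k]≡1 = trans (cong mod3 (trans (height-step n (v / k) 1≤v/k (subst (_≤ n) v≡k[v/k] v≤n))
                   (cong (λ z → suc (height n z)) (sym v≡k[v/k])))) (mod3-suc-0 (height n v) h≡0)

    multiple-∈B : ∀ v → 1 ≤ v → mod3 (height n v) ≡ 2 → memberᵇ B (k * v) ≡ true
    multiple-∈B v 1≤v h≡2 with height n v in h[v]
    ... | suc t = trans (memberᵇ-B (k * v) (1≤k* 1≤v) kv≤n) (inB-1mod3 n (k * v) (mod3-suc≡2 (height n (k * v)) h[kv]+1≡2))
      where
      kv≤n : k * v ≤ n
      kv≤n = height≡suc⇒k*≤ n v t h[v]
      h[kv]+1≡2 : mod3 (suc (height n (k * v))) ≡ 2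
      h[kv]+1≡2 = trans (cong mod3 (trans (sym (height-step n v 1≤v kv≤n)) h[v])) h≡2

    B-conflict : ∀ v → 1 ≤ v → v ≤ n → inB n v ≡ false →
      (memberᵇ B (k * v) ≡ true) ⊎ (Σ ℕ λ w → (v ≡ k * w) × (memberᵇ B w ≡ true))
    B-conflict v 1≤v v≤n v∉B with mod3-cases (height n v)
    ... | inj₂ (inj₁ h≡1) = ⊥-elim (true≢false (trans (sym (inB-1mod3 n v h≡1)) v∉B))
    ... | inj₂ (inj₂ h≡2) = inj₁ (multiple-∈B v 1≤v h≡2)
    ... | inj₁ h≡0 = inj₂ (divisor-∈B v 1≤v v≤n h≡0 (not-injective (trans (sym (inB-0mod3 n v h≡0)) v∉B)))

    B-maximal : MaximalKFree k B
    B-maximal = memberᵇ-MaximalKFree k B B-KFree λ v 1≤v v≤n v∉ᵇB →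
      B-conflict v 1≤v v≤n (trans (sym (memberᵇ-B v 1≤v v≤n)) v∉ᵇB)

    lift : ℕ → ℕ
    lift x = if height≡0mod3 n x then x else k * x

    lift-spec : ∀ x → 1 ≤ x → x ≤ n → inB n x ≡ true → (1 ≤ lift x) × (lift x ≤ n) × (height≡0mod3 n (lift x) ≡ true)
    lift-spec x 1≤x x≤n x∈B with height≡0mod3 n x in x₀
    ... | true = 1≤x , x≤n , x₀
    ... | false with height n x in h[x]
    ...   | suc t = 1≤k* 1≤x , kx≤n , ≡⇒≡ᵇ≡true (mod3-suc≡1 (height n (k * x)) h[kx]+1≡1)
      where
      kx≤n : k * x ≤ n
      kx≤n = height≡suc⇒k*≤ n x t h[x]
      h[x]≡1 : mod3 (suc t) ≡ 1
      h[x]≡1 with mod3-cases (suc t)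
      ... | inj₁ h≡0 = ⊥-elim (true≢false (trans (sym (≡⇒≡ᵇ≡true h≡0)) x₀))
      ... | inj₂ (inj₁ h≡1) = h≡1
      ... | inj₂ (inj₂ h≡2) rewrite h≡2 = ⊥-elim (true≢false (sym x∈B))
      h[kx]+1≡1 : mod3 (suc (height n (k * x))) ≡ 1
      h[kx]+1≡1 = trans (cong mod3 (trans (sym (height-step n x 1≤x kx≤n)) h[x])) h[x]≡1

    lift-cases : ∀ x → ((mod3 (height n x) ≡ 0) × (lift x ≡ x)) ⊎ (lift x ≡ k * x)
    lift-cases x with height≡0mod3 n x in x₀
    ... | true = inj₁ (≡ᵇ≡true⇒≡ x₀ , refl)
    ... | false = inj₂ refl

    lift-injective : ∀ x y → 1 ≤ x → x ≤ n → 1 ≤ y → y ≤ n → inB n x ≡ true → inB n y ≡ true → lift x ≡ lift y → x ≡ y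
    lift-injective x y _ _ _ _ x∈B y∈B eq with lift-cases x | lift-cases y
    ... | inj₁ (_ , a) | inj₁ (_ , b) = trans (sym a) (trans eq b)
    ... | inj₂ a | inj₂ b = *-cancelˡ-≡ x y k (trans (sym a) (trans eq b))
    ... | inj₁ (x₀ , a) | inj₂ b =
      ⊥-elim (true≢false (trans (sym x∈B) (inB-k*-0mod3 n x y (trans (sym a) (trans eq b)) x₀)))
    ... | inj₂ a | inj₁ (y₀ , b) =
      ⊥-elim (true≢false (trans (sym y∈B) (inB-k*-0mod3 n y x (trans (sym b) (trans (sym eq) a)) y₀)))

    ∣B∣≤N₀ : ∣ B ∣ ≤ N₀ n
    ∣B∣≤N₀ = subst (_≤ N₀ n) (sym (trans (∣A∣≡count-memberᵇ B) (count-cong n memberᵇ-B)))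
      (count-≤-injection n n (inB n) (height≡0mod3 n) lift lift-spec lift-injective)

  n<k^n : ∀ n → n < k ^ n
  n<k^n zero = s≤s z≤n
  n<k^n (suc n) = begin-strict
    suc n                     <⟨ s≤s (n<k^n n) ⟩
    suc (k ^ n)               ≤⟨ <k* (m^n>0 k n) ⟩
    k ^ suc n                 ∎
    where open ≤-Reasoning

  logSearch-upper : ∀ n fuel e → k ^ e ≤ n → e + fuel ≡ n → n < k ^ suc (logSearch k n e fuel)
  logSearch-upper n zero e k^e≤n e+0≡n =
    ⊥-elim (<⇒≱ (n<k^n e) (subst (k ^ e ≤_) (sym (trans (sym (+-identityʳ e)) e+0≡n)) k^e≤n))
  logSearch-upper n (suc fuel) e k^e≤n e+1+fuel≡n with k ^ suc e ≤? n
  ... | yes k^[1+e]≤n = logSearch-upper n fuel (suc e) k^[1+e]≤n (trans (sym (+-suc e fuel)) e+1+fuel≡n)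
  ... | no k^[1+e]≰n = ≰⇒> k^[1+e]≰n

  logSearch-lower : ∀ n fuel e → e ≤ logSearch k n e fuel
  logSearch-lower n zero e = ≤-refl
  logSearch-lower n (suc fuel) e with k ^ suc e ≤? n
  ... | yes _ = ≤-trans (n≤1+n e) (logSearch-lower n fuel (suc e))
  ... | no _ = ≤-refl

  n<k^[1+floorLog] : ∀ n → 1 ≤ n → n < k ^ suc (floorLog k n)
  n<k^[1+floorLog] n 1≤n = logSearch-upper n n 0 1≤n refl

  1≤floorLog : ∀ n → k ≤ n → 1 ≤ floorLog k n
  1≤floorLog (suc n) k≤1+n with k ^ 1 ≤? suc n
  ... | yes _ = logSearch-lower (suc n) n 1
  ... | no k¹≰1+n = ⊥-elim (k¹≰1+n (subst (_≤ suc n) (sym (*-identityʳ k)) k≤1+n))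

  Rtilde≡N₀ : ∀ n → Rtilde k n ≡ N₀ n
  Rtilde≡N₀ n with Rtilde-spec k n ∣ B n ∣ (∣p∣≤n (B n)) (B n , B-maximal n , refl)
  ... | R≤∣B∣ , A , A-maximal , ∣A∣≡R =
    ≤-antisym (≤-trans R≤∣B∣ (∣B∣≤N₀ n)) (subst (N₀ n ≤_) ∣A∣≡R (N₀≤∣A∣ A A-maximal))

  c*[1+L]≤2c*L² : ∀ L → 1 ≤ L → c * suc L ≤ (2 * c) * L ^ 2
  c*[1+L]≤2c*L² L 1≤L = begin
    c * suc L            ≤⟨ *-monoʳ-≤ c (+-monoˡ-≤ L 1≤L) ⟩
    c * (L + L)          ≡⟨ double c L ⟩
    (2 * c) * (L * 1)    ≤⟨ *-monoʳ-≤ (2 * c) (*-monoʳ-≤ L (≤-trans 1≤L (≤-reflexive (sym (*-identityʳ L))))) ⟩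
    (2 * c) * L ^ 2      ∎
    where
    open ≤-Reasoning
    double : ∀ c L → c * (L + L) ≡ (2 * c) * (L * 1)
    double = solve-∀

theorem6 : ∀ (k : ℕ) → 2 ≤ k →
    Σ ℕ λ C → Σ ℕ λ N → ∀ (n : ℕ) → N ≤ n →
      ((k * k + k + 1) * Rtilde k n ≤ k * k * n + C * (floorLog k n) ^ 2)
      × (k * k * n ≤ (k * k + k + 1) * Rtilde k n + C * (floorLog k n) ^ 2)
theorem6 (suc (suc j)) (s≤s (s≤s z≤n)) = 2 * c j , k j , λ n k≤n →
  let L = floorLog (k j) n
      error≤ = c*[1+L]≤2c*L² j L (1≤floorLog j n k≤n)
      n<k³^[1+L] = ≤-trans (n<k^[1+floorLog] j n (≤-trans (s≤s z≤n) k≤n)) (^-monoˡ-≤ (suc L) (k≤k³ j))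
      (upper , lower) = N₀-approx j (suc L) n n<k³^[1+L]
  in subst (λ R → P j * R ≤ Q j * n + 2 * c j * L ^ 2) (sym (Rtilde≡N₀ j n)) (≤-trans upper (+-monoʳ-≤ (Q j * n) error≤))
   , subst (λ R → Q j * n ≤ P j * R + 2 * c j * L ^ 2) (sym (Rtilde≡N₀ j n)) (≤-trans lower (+-monoʳ-≤ (P j * N₀ j n) error≤))
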